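{- Let $n,r\ge1$ be integers and $\mathbf t=(t_1,\dots,t_n)\in\mathbb{Z}_{\ge0}^n$ with $t_1\le t_2\le\cdots\le t_n$; put $K_i=2^{t_i}$. Let $\boldsymbol\delta=(\delta_1,\dots,\delta_n)\in\mathbb{Z}^n$ with $0\le\delta_i\le t_i$, and let $\sigma$ be a permutation of $\{1,\dots,n\}$ such that $t_{\sigma(1)}-\delta_{\sigma(1)}\le\cdots\le t_{\sigma(n)}-\delta_{\sigma(n)}$. Write $\|2^{\boldsymbol\delta}\|=\prod_i2^{\delta_i}$ and $2^{\mathbf t_\sigma-\boldsymbol\delta_\sigma}=(2^{t_{\sigma(1)}-\delta_{\sigma(1)}},\dots,2^{t_{\sigma(n)}-\delta_{\sigma(n)}})$. Then for each $0\le j\le n$, $$\|2^{\boldsymbol\delta}\|^{ -(2r-1)}B_{n,r,j}(2^{\mathbf t_\sigma-\boldsymbol\delta_\sigma})^{ -1}\le\begin{cases}1 & j=0,\\ K_1^{ -\theta_j} & 1\le j\le n-1,\\ (K_1\cdots K_{n/2})^{ -(2r-1)} & j=n,\ n\text{ even},\\ (K_1\cdots K_{(n-1)/2})^{ -(2r-1)}K_{(n+1)/2}^{ -r} & j=n,\ n\text{ odd}.\end{cases}$$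
   Context: For $n\ge2$: $\theta_j=j\lfloor(r-1)/(n-1)\rfloor$ for $1\le j\le n-2$ and $\theta_{n-1}=r-1$. For $1\le k_1\le\cdots\le k_n$: $B_{n,r,0}(\mathbf k)=1$; $B_{n,r,j}(\mathbf k)=k_1^{\theta_j}$ for $1\le j\le n-1$; $B_{n,r,n}(\mathbf k)=(k_1\cdots k_{n/2})^{2r}$ if $n$ even and $(k_1\cdots k_{(n-1)/2})^{2r}k_{(n+1)/2}^r$ if $n$ odd. -}

module Defs where

open import Data.Nat using (ℕ; zero; suc; _+_; _*_; _∸_; _^_; _≤_; _<_; _<ᵇ_; _/_; s≤s)
open import Data.Nat.DivMod using (m/n≤m)
open import Data.Fin using (Fin; toℕ; fromℕ<)
open import Data.Bool using (Bool; true; false; if_then_else_)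
open import Data.Integer using (+_)
import Data.Rational as ℚ

∏ : ∀ {n} → (Fin n → ℕ) → ℕ
∏ {zero}  f = 1
∏ {suc n} f = f Fin.zero * ∏ (λ i → f (Fin.suc i))

-- Product of the first m entries k_1 ⋯ k_m of k (k_1 is the entry at index 0).
prefixProd : ∀ {n} → ℕ → (Fin n → ℕ) → ℕ
prefixProd m k = ∏ (λ i → if toℕ i <ᵇ m then k i else 1)

-- θ_j = j ⌊(r-1)/(n-1)⌋ for 1 ≤ j ≤ n-2, and θ_{n-1} = r-1.
-- (Only used for n ≥ 2 and 1 ≤ j ≤ n-1.)
θ : (n r j : ℕ) → ℕ
θ n r j with n ∸ 1
... | zero    = r ∸ 1
... | suc n-2 = if j <ᵇ suc n-2 then j * ((r ∸ 1) / suc n-2) else r ∸ 1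

isEven : ℕ → Bool
isEven zero          = true
isEven (suc zero)    = false
isEven (suc (suc n)) = isEven n

-- the 0-indexed position (n-1)/2 of k_{(n+1)/2} is < n
mid< : ∀ {n} → 1 ≤ n → (n ∸ 1) / 2 < n
mid< {suc m} _ = s≤s (m/n≤m m 2)

-- B_{n,r,j}(k) for k = (k_1,…,k_n) : Fin n → ℕ (k_1 at index 0), n ≥ 1, 0 ≤ j ≤ n.
B : (n r j : ℕ) → 1 ≤ n → (Fin n → ℕ) → ℕ
B n r zero    h k = 1
B n r (suc j) h k =
  if suc j <ᵇ n
  then k (fromℕ< h) ^ θ n r (suc j)
  else (if isEven n
        then prefixProd (n / 2) k ^ (2 * r)
        else prefixProd ((n ∸ 1) / 2) k ^ (2 * r) * k (fromℕ< (mid< h)) ^ r)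

-- reciprocal 1/m of a natural number as a rational (convention 1/0 = 0; only
-- ever applied to positive numbers here)
recip : ℕ → ℚ.ℚ
recip zero    = ℚ.0ℚ
recip (suc m) = (+ 1) ℚ./ suc m

bound : (n r j : ℕ) → 1 ≤ n → (Fin n → ℕ) → ℚ.ℚ
bound n r zero    h t = ℚ.1ℚ
bound n r (suc j) h t =
  if suc j <ᵇ n
  then recip (K (fromℕ< h) ^ θ n r (suc j))
  else (if isEven n
        then recip (prefixProd (n / 2) K ^ (2 * r ∸ 1))
        else recip (prefixProd ((n ∸ 1) / 2) K ^ (2 * r ∸ 1))
               ℚ.* recip (K (fromℕ< (mid< h)) ^ r))
  where
  K : Fin _ → ℕ
  K i = 2 ^ t i

module Submission where

-- Every quantity is a power of two, so the inequality is one between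
-- exponents.  Write |δ| = Σᵢ δᵢ, s = (t - δ) ∘ σ, and Sₖ(f) for the sum of
-- the first k entries of f.  The heart of the proof is the majorisation
--     Sₖ(t) ≤ Sₖ(s) + |δ|      for every k,                           (★)
-- which follows from the rearrangement fact that for sorted t the first k
-- entries have the smallest sum among all k entries (Sₖ(t) ≤ Sₖ(t ∘ σ)),
-- together with t ∘ σ = s + δ ∘ σ and Sₖ(δ ∘ σ) ≤ |δ|.

open import Defs
open import Data.Nat using (ℕ; zero; suc; _+_; _*_; _∸_; _^_; _≤_; _<_; _<ᵇ_; _/_; s≤s; z≤n)
import Data.Nat.Properties as NP
open import Data.Nat.DivMod using (m/n*n≤m)
open import Data.Nat.Tactic.RingSolver using (solve-∀)
open import Data.Fin using (Fin; fromℕ<; punchIn)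
import Data.Fin as F
import Data.Fin.Properties as FP
open import Data.Fin.Permutation using (Permutation; _⟨$⟩ʳ_; remove; punchIn-permute)
open import Algebra.Properties.CommutativeMonoid.Sum NP.+-0-commutativeMonoid using (sum; sum-permute)
open import Data.Bool using (true; false; T)
open import Function using (_∘_)
open import Relation.Binary.PropositionalEquality
import Data.Integer as ℤ
import Data.Integer.Properties as ℤP
import Data.Rational as ℚ
import Data.Rational.Properties as QP
import Data.Rational.Unnormalised as U
import Data.Rational.Unnormalised.Properties as UP

recip-toℚᵘ : ∀ a → ℚ.toℚᵘ (recip (suc a)) U.≃ U.mkℚᵘ (ℤ.+ 1) a
recip-toℚᵘ a = QP.toℚᵘ-fromℚᵘ (U.mkℚᵘ (ℤ.+ 1) a)

recip-* : ∀ {x y} → 0 < x → 0 < y → recip x ℚ.* recip y ≡ recip (x * y)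
recip-* {suc a} {suc b} _ _ = QP.toℚᵘ-injective
  (UP.≃-trans (QP.toℚᵘ-homo-* (recip (suc a)) (recip (suc b)))
  (UP.≃-trans (UP.*-cong (recip-toℚᵘ a) (recip-toℚᵘ b))
              (UP.≃-sym (recip-toℚᵘ (b + a * suc b)))))

recip-antitone : ∀ {x y} → 0 < x → x ≤ y → recip y ℚ.≤ recip x
recip-antitone {suc a} {suc b} _ (s≤s a≤b) = QP.toℚᵘ-cancel-≤
  (UP.≤-respʳ-≃ (UP.≃-sym (recip-toℚᵘ a)) (UP.≤-respˡ-≃ (UP.≃-sym (recip-toℚᵘ b))
    (U.*≤* (subst₂ ℤ._≤_ (sym (ℤP.*-identityˡ _)) (sym (ℤP.*-identityˡ _)) (ℤ.+≤+ (s≤s a≤b))))))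

recip-2^-+ : ∀ a b → recip (2 ^ a) ℚ.* recip (2 ^ b) ≡ recip (2 ^ (a + b))
recip-2^-+ a b = trans (recip-* (NP.m^n>0 2 a) (NP.m^n>0 2 b))
                       (cong recip (sym (NP.^-distribˡ-+-* 2 a b)))

pow2-recip-≤ : ∀ {P Q R} a b c → P ≡ 2 ^ a → Q ≡ 2 ^ b → R ≡ 2 ^ c → c ≤ a + b →
               recip P ℚ.* recip Q ℚ.≤ recip R
pow2-recip-≤ a b c refl refl refl c≤a+b =
  subst (ℚ._≤ recip (2 ^ c)) (sym (recip-2^-+ a b))
        (recip-antitone (NP.m^n>0 2 c) (NP.^-monoʳ-≤ 2 c≤a+b))

pow2-recip-≤₂ : ∀ {P Q R₁ R₂} a b c₁ c₂ → P ≡ 2 ^ a → Q ≡ 2 ^ b →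
                R₁ ≡ 2 ^ c₁ → R₂ ≡ 2 ^ c₂ → c₁ + c₂ ≤ a + b →
                recip P ℚ.* recip Q ℚ.≤ recip R₁ ℚ.* recip R₂
pow2-recip-≤₂ a b c₁ c₂ P≡ Q≡ refl refl h =
  subst (_ ℚ.≤_) (sym (recip-2^-+ c₁ c₂)) (pow2-recip-≤ a b (c₁ + c₂) P≡ Q≡ refl h)

prefixSum : ∀ {n} → ℕ → (Fin n → ℕ) → ℕ
prefixSum zero    f = 0
prefixSum {zero}  (suc k) f = 0
prefixSum {suc n} (suc k) f = f F.zero + prefixSum k (f ∘ F.suc)

prefixSum-cong : ∀ {n} k {f g : Fin n → ℕ} → (∀ i → f i ≡ g i) → prefixSum k f ≡ prefixSum k g
prefixSum-cong zero              f≗g = refl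
prefixSum-cong {zero}  (suc k)   f≗g = refl
prefixSum-cong {suc n} (suc k)   f≗g = cong₂ _+_ (f≗g F.zero) (prefixSum-cong k (f≗g ∘ F.suc))

prefixSum-+ : ∀ {n} k (f g : Fin n → ℕ) → prefixSum k (λ i → f i + g i) ≡ prefixSum k f + prefixSum k g
prefixSum-+ zero              f g = refl
prefixSum-+ {zero}  (suc k)   f g = refl
prefixSum-+ {suc n} (suc k)   f g = trans
  (cong (f F.zero + g F.zero +_) (prefixSum-+ k (f ∘ F.suc) (g ∘ F.suc)))
  (interchange (f F.zero) (g F.zero) _ _)
  where
  interchange : ∀ a b c d → (a + b) + (c + d) ≡ (a + c) + (b + d)
  interchange = solve-∀

prefixSum-≤-sum : ∀ {n} k (f : Fin n → ℕ) → prefixSum k f ≤ sum f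
prefixSum-≤-sum zero            f = z≤n
prefixSum-≤-sum {zero}  (suc k) f = z≤n
prefixSum-≤-sum {suc n} (suc k) f = NP.+-monoʳ-≤ (f F.zero) (prefixSum-≤-sum k (f ∘ F.suc))

prefixSum-extend : ∀ {n} m (m<n : m < n) (f : Fin n → ℕ) →
                   prefixSum (suc m) f ≡ prefixSum m f + f (fromℕ< m<n)
prefixSum-extend {suc n} zero    _          f = NP.+-identityʳ (f F.zero)
prefixSum-extend {suc n} (suc m) (s≤s m<n) f =
  trans (cong (f F.zero +_) (prefixSum-extend m m<n (f ∘ F.suc))) (sym (NP.+-assoc (f F.zero) _ _))

Sorted : ∀ {n} → (Fin n → ℕ) → Set
Sorted t = ∀ i i′ → i F.≤ i′ → t i ≤ t i′

sorted-punchIn : ∀ {n} {t : Fin (suc n) → ℕ} → Sorted t → ∀ a → Sorted (t ∘ punchIn a)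
sorted-punchIn sorted a i i′ i≤i′ = sorted _ _ (FP.punchIn-mono-≤ a i i′ i≤i′)

prefixSum-punchIn : ∀ {n} {t : Fin (suc n) → ℕ} → Sorted t → ∀ a k →
                    prefixSum (suc k) t ≤ t a + prefixSum k (t ∘ punchIn a)
prefixSum-punchIn             sorted F.zero    k       = NP.≤-refl
prefixSum-punchIn {suc n}     sorted (F.suc a) zero    = NP.+-monoˡ-≤ 0 (sorted F.zero (F.suc a) z≤n)
prefixSum-punchIn {suc n} {t} sorted (F.suc a) (suc k) = NP.≤-trans
  (NP.+-monoʳ-≤ (t F.zero) (prefixSum-punchIn (λ i i′ i≤i′ → sorted _ _ (s≤s i≤i′)) a k))
  (NP.≤-reflexive (swap (t F.zero) (t (F.suc a)) _))
  where
  swap : ∀ x y z → x + (y + z) ≡ y + (x + z)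
  swap = solve-∀

prefixSum-rearrange : ∀ {n} (σ : Permutation n n) {t : Fin n → ℕ} → Sorted t →
                      ∀ k → prefixSum k t ≤ prefixSum k (t ∘ (σ ⟨$⟩ʳ_))
prefixSum-rearrange         σ     sorted zero    = z≤n
prefixSum-rearrange {zero}  σ     sorted (suc k) = z≤n
prefixSum-rearrange {suc n} σ {t} sorted (suc k) = NP.≤-trans
  (prefixSum-punchIn sorted a k)
  (NP.+-monoʳ-≤ (t a) (NP.≤-trans
    (prefixSum-rearrange (remove F.zero σ) (sorted-punchIn sorted a) k)
    (NP.≤-reflexive (prefixSum-cong k (λ j → cong t (sym (punchIn-permute σ F.zero j)))))))
  where a = σ ⟨$⟩ʳ F.zero

∏-const-1 : ∀ n → ∏ {n} (λ _ → 1) ≡ 1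
∏-const-1 zero    = refl
∏-const-1 (suc n) = trans (NP.+-identityʳ _) (∏-const-1 n)

∏-pow2 : ∀ {n} (f : Fin n → ℕ) → ∏ (λ i → 2 ^ f i) ≡ 2 ^ sum f
∏-pow2 {zero}  f = refl
∏-pow2 {suc n} f = trans (cong (2 ^ f F.zero *_) (∏-pow2 (f ∘ F.suc)))
                         (sym (NP.^-distribˡ-+-* 2 (f F.zero) _))

prefixProd-pow2 : ∀ {n} m (f : Fin n → ℕ) → prefixProd m (λ i → 2 ^ f i) ≡ 2 ^ prefixSum m f
prefixProd-pow2 {n}     zero    f = ∏-const-1 n
prefixProd-pow2 {zero}  (suc m) f = refl
prefixProd-pow2 {suc n} (suc m) f = trans (cong (2 ^ f F.zero *_) (prefixProd-pow2 m (f ∘ F.suc)))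
                                          (sym (NP.^-distribˡ-+-* 2 (f F.zero) _))

prefixProd-pow2-^ : ∀ {n} m (f : Fin n → ℕ) e →
                    prefixProd m (λ i → 2 ^ f i) ^ e ≡ 2 ^ (prefixSum m f * e)
prefixProd-pow2-^ m f e = trans (cong (_^ e) (prefixProd-pow2 m f)) (NP.^-*-assoc 2 (prefixSum m f) e)

θ-≤ : ∀ n r j → θ n r j ≤ r ∸ 1
θ-≤ n r j with n ∸ 1
... | zero = NP.≤-refl
... | suc m with j <ᵇ suc m in j<ᵇ
... | false = NP.≤-refl
... | true  = begin
  j * ((r ∸ 1) / suc m)      ≤⟨ NP.*-monoˡ-≤ _ (NP.<⇒≤ (NP.<ᵇ⇒< j (suc m) (subst T (sym j<ᵇ) _))) ⟩
  suc m * ((r ∸ 1) / suc m)  ≡⟨ NP.*-comm (suc m) _ ⟩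
  ((r ∸ 1) / suc m) * suc m  ≤⟨ m/n*n≤m (r ∸ 1) (suc m) ⟩
  r ∸ 1                      ∎
  where open NP.≤-Reasoning

weight-split : ∀ c → 2 * suc c ∸ 1 ≡ c + suc c
weight-split c = cong (c +_) (NP.+-identityʳ (suc c))

weight-≤ : ∀ c → 2 * suc c ∸ 1 ≤ 2 * suc c
weight-≤ c = NP.m∸n≤m (2 * suc c) 1

scaled-≤ : ∀ {θ w v P S E} → θ ≤ w → θ ≤ v → P ≤ S + E → P * θ ≤ E * w + S * v
scaled-≤ {θ} {w} {v} {P} {S} {E} θ≤w θ≤v P≤S+E = begin
  P * θ          ≤⟨ NP.*-monoˡ-≤ θ P≤S+E ⟩
  (S + E) * θ    ≡⟨ distrib S E θ ⟩
  E * θ + S * θ  ≤⟨ NP.+-mono-≤ (NP.*-monoʳ-≤ E θ≤w) (NP.*-monoʳ-≤ S θ≤v) ⟩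
  E * w + S * v  ∎
  where
  open NP.≤-Reasoning
  distrib : ∀ x y z → (x + y) * z ≡ y * z + x * z
  distrib = solve-∀

scaled₂-≤ : ∀ {a b v P T S U E} → a + b ≤ v → P ≤ S + E → P + T ≤ S + U + E →
            P * (a + b) + T * b ≤ E * (a + b) + (S * v + U * b)
scaled₂-≤ {a} {b} {v} {P} {T} {S} {U} {E} a+b≤v P≤S+E P+T≤S+U+E = begin
  P * (a + b) + T * b                ≡⟨ regroup P T a b ⟩
  P * a + (P + T) * b                ≤⟨ NP.+-mono-≤ (NP.*-monoˡ-≤ a P≤S+E) (NP.*-monoˡ-≤ b P+T≤S+U+E) ⟩
  (S + E) * a + (S + U + E) * b      ≡⟨ collect S U E a b ⟩
  E * (a + b) + (S * (a + b) + U * b) ≤⟨ NP.+-monoʳ-≤ (E * (a + b)) (NP.+-monoˡ-≤ (U * b) (NP.*-monoʳ-≤ S a+b≤v)) ⟩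
  E * (a + b) + (S * v + U * b)      ∎
  where
  open NP.≤-Reasoning
  regroup : ∀ P T a b → P * (a + b) + T * b ≡ P * a + (P + T) * b
  regroup = solve-∀
  collect : ∀ S U E a b → (S + E) * a + (S + U + E) * b ≡ E * (a + b) + (S * (a + b) + U * b)
  collect = solve-∀

module Setting {m c : ℕ} (t δ : Fin (suc m) → ℕ) (σ : Permutation (suc m) (suc m))
               (sorted : Sorted t) (δ≤t : ∀ i → δ i ≤ t i) where

  s : Fin (suc m) → ℕ
  s i = t (σ ⟨$⟩ʳ i) ∸ δ (σ ⟨$⟩ʳ i)

  w : ℕ
  w = 2 * suc c ∸ 1

  majorised : ∀ k → prefixSum k t ≤ prefixSum k s + sum δ
  majorised k = begin
    prefixSum k t                           ≤⟨ prefixSum-rearrange σ sorted k ⟩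
    prefixSum k (t ∘ σʳ)                    ≡⟨ prefixSum-cong k (λ i → sym (NP.m∸n+n≡m (δ≤t (σʳ i)))) ⟩
    prefixSum k (λ i → s i + δ (σʳ i))      ≡⟨ prefixSum-+ k s (δ ∘ σʳ) ⟩
    prefixSum k s + prefixSum k (δ ∘ σʳ)    ≤⟨ NP.+-monoʳ-≤ _ (prefixSum-≤-sum k (δ ∘ σʳ)) ⟩
    prefixSum k s + sum (δ ∘ σʳ)            ≡⟨ cong (prefixSum k s +_) (sym (sum-permute δ σ)) ⟩
    prefixSum k s + sum δ                   ∎
    where
    open NP.≤-Reasoning
    σʳ : Fin (suc m) → Fin (suc m)
    σʳ = σ ⟨$⟩ʳ_

  majorised-extend : ∀ k (k<n : k < suc m) →
                     prefixSum k t + t (fromℕ< k<n) ≤ prefixSum k s + s (fromℕ< k<n) + sum δ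
  majorised-extend k k<n = subst₂ (λ x y → x ≤ y + sum δ)
    (prefixSum-extend k k<n t) (prefixSum-extend k k<n s) (majorised (suc k))

  norm-pow2 : ∏ (λ i → 2 ^ δ i) ^ w ≡ 2 ^ (sum δ * w)
  norm-pow2 = trans (cong (_^ w) (∏-pow2 δ)) (NP.^-*-assoc 2 (sum δ) w)

  case-zero : recip (∏ (λ i → 2 ^ δ i) ^ w) ℚ.* recip 1 ℚ.≤ ℚ.1ℚ
  case-zero = pow2-recip-≤ (sum δ * w) 0 0 norm-pow2 refl refl z≤n

  case-middle : ∀ θ′ → θ′ ≤ c →
    recip (∏ (λ i → 2 ^ δ i) ^ w) ℚ.* recip ((2 ^ s F.zero) ^ θ′) ℚ.≤ recip ((2 ^ t F.zero) ^ θ′)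
  case-middle θ′ θ′≤c = pow2-recip-≤ (sum δ * w) (s F.zero * θ′) (t F.zero * θ′) norm-pow2 (NP.^-*-assoc 2 (s F.zero) θ′) (NP.^-*-assoc 2 (t F.zero) θ′)
    (scaled-≤ {S = s F.zero} {E = sum δ} (NP.≤-trans θ′≤c (subst (c ≤_) (sym (weight-split c)) (NP.m≤m+n c (suc c))))
              NP.≤-refl (majorised-extend 0 (s≤s z≤n)))

  case-even : ∀ half →
    recip (∏ (λ i → 2 ^ δ i) ^ w) ℚ.* recip (prefixProd half (λ i → 2 ^ s i) ^ (2 * suc c))
      ℚ.≤ recip (prefixProd half (λ i → 2 ^ t i) ^ w)
  case-even half = pow2-recip-≤ (sum δ * w) (prefixSum half s * (2 * suc c)) (prefixSum half t * w) norm-pow2 (prefixProd-pow2-^ half s _) (prefixProd-pow2-^ half t w)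
    (scaled-≤ {S = prefixSum half s} {E = sum δ} NP.≤-refl (weight-≤ c) (majorised half))

  case-odd : ∀ half (half<n : half < suc m) →
    recip (∏ (λ i → 2 ^ δ i) ^ w)
      ℚ.* recip (prefixProd half (λ i → 2 ^ s i) ^ (2 * suc c) * (2 ^ s (fromℕ< half<n)) ^ suc c)
      ℚ.≤ recip (prefixProd half (λ i → 2 ^ t i) ^ w) ℚ.* recip ((2 ^ t (fromℕ< half<n)) ^ suc c)
  case-odd half half<n = pow2-recip-≤₂ (sum δ * w) s-exponent (prefixSum half t * w) (t mid * suc c)
    norm-pow2 s-pow2 (prefixProd-pow2-^ half t w) (NP.^-*-assoc 2 (t mid) (suc c)) exponents
    where
    mid : Fin (suc m)
    mid = fromℕ< half<n

    s-exponent : ℕ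
    s-exponent = prefixSum half s * (2 * suc c) + s mid * suc c

    s-pow2 : prefixProd half (λ i → 2 ^ s i) ^ (2 * suc c) * (2 ^ s mid) ^ suc c ≡ 2 ^ s-exponent
    s-pow2 = trans (cong₂ _*_ (prefixProd-pow2-^ half s (2 * suc c)) (NP.^-*-assoc 2 (s mid) (suc c)))
                   (sym (NP.^-distribˡ-+-* 2 (prefixSum half s * (2 * suc c)) (s mid * suc c)))

    exponents : prefixSum half t * w + t mid * suc c ≤ sum δ * w + s-exponent
    exponents = subst (λ v → prefixSum half t * v + t mid * suc c ≤ sum δ * v + s-exponent)
      (sym (weight-split c))
      (scaled₂-≤ {S = prefixSum half s} {U = s mid} {E = sum δ} (subst (_≤ 2 * suc c) (weight-split c) (weight-≤ c))
                 (majorised half) (majorised-extend half half<n))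

lemma6p3 : (n r : ℕ) (hn : 1 ≤ n) → 1 ≤ r →
    (t : Fin n → ℕ) → (∀ i i′ → i F.≤ i′ → t i ≤ t i′) →
    (δ : Fin n → ℕ) → (∀ i → δ i ≤ t i) →
    (σ : Permutation n n) →
    (∀ i i′ → i F.≤ i′ → t (σ ⟨$⟩ʳ i) ∸ δ (σ ⟨$⟩ʳ i) ≤ t (σ ⟨$⟩ʳ i′) ∸ δ (σ ⟨$⟩ʳ i′)) →
    (j : ℕ) → j ≤ n →
    recip (∏ (λ i → 2 ^ δ i) ^ (2 * r ∸ 1))
      ℚ.* recip (B n r j hn (λ i → 2 ^ (t (σ ⟨$⟩ʳ i) ∸ δ (σ ⟨$⟩ʳ i))))
      ℚ.≤ bound n r j hn t
lemma6p3 (suc m) zero    _          ()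
lemma6p3 (suc m) (suc c) (s≤s z≤n) _ t sorted δ δ≤t σ _ zero    _ = case-zero
  where open Setting {m} {c} t δ σ sorted δ≤t
lemma6p3 (suc m) (suc c) (s≤s z≤n) _ t sorted δ δ≤t σ _ (suc j) _ with j <ᵇ m | isEven (suc m)
... | true  | _     = case-middle (θ (suc m) (suc c) (suc j)) (θ-≤ (suc m) (suc c) (suc j))
  where open Setting {m} {c} t δ σ sorted δ≤t
... | false | true  = case-even (suc m / 2)
  where open Setting {m} {c} t δ σ sorted δ≤t
... | false | false = case-odd (m / 2) (mid< {suc m} (s≤s z≤n))
  where open Setting {m} {c} t δ σ sorted δ≤t
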